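{- Let $k$ be a positive integer. For every increasing unbounded function $f: \mathbb N_1 \to \mathbb N_1$ there is a uniformly recurrent word $w \in \{0,1\}^\omega$ such that $\mathcal P^{(k)}_w(n) = O(f(n))$ (as $n \to \infty$) but $\mathcal P^{(k)}_w$ is not bounded.
   Context: $\mathbb N_1$ is the set of positive integers. For a finite word $u$ and a nonempty word $x$, $|u|_x$ denotes the number of occurrences of $x$ as a factor of $u$. Two finite words $u, v$ are $k$-Abelian equivalent if $|u|_x = |v|_x$ for all nonempty words $x$ of length at most $k$. For an infinite word $w$, $\mathcal P^{(k)}_w(n)$ is the number of $k$-Abelian equivalence classes among the factors of $w$ of length $n$. An infinite word $w$ is uniformly recurrent if for every factor $u$ of $w$ there is an $N$ such that every factor of $w$ of length $N$ contains $u$. -}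

module Defs where

open import Data.Bool using (Bool; true; false; _∧_; if_then_else_)
open import Data.Bool.Properties using () renaming (_≟_ to _≟ᵇ_)
open import Data.Nat using (ℕ; zero; suc; _+_; _*_; _∸_; _≤_; _<_)
open import Data.List using (List; []; _∷_; length; take; drop)
open import Data.List.Relation.Unary.All using (All)
open import Data.List.Relation.Unary.AllPairs using (AllPairs)
open import Data.List.Relation.Unary.Any using (Any)
open import Data.Product using (Σ; ∃; _×_; _,_)
open import Relation.Binary.PropositionalEquality using (_≡_)
open import Relation.Nullary using (¬_; does)

Word : Set
Word = List Bool

InfWord : Set
InfWord = ℕ → Bool

isPrefix : Word → Word → Bool
isPrefix [] u = true
isPrefix (a ∷ x) [] = false
isPrefix (a ∷ x) (b ∷ u) = does (a ≟ᵇ b) ∧ isPrefix x u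

-- |u|_x : number of occurrences of x as a factor of u (x nonempty in all uses)
occ : Word → Word → ℕ
occ x [] = 0
occ x (b ∷ u) = (if isPrefix x (b ∷ u) then 1 else 0) + occ x u

KAbEq : ℕ → Word → Word → Set
KAbEq k u v = (x : Word) → 1 ≤ length x → length x ≤ k → occ x u ≡ occ x v

factor : InfWord → ℕ → ℕ → Word
factor w i zero = []
factor w i (suc n) = w i ∷ factor w (suc i) n

IsFactor : InfWord → Word → Set
IsFactor w u = ∃ λ i → factor w i (length u) ≡ u

IsFactorOf : Word → Word → Set
IsFactorOf u v = ∃ λ i → i + length u ≤ length v × take (length u) (drop i v) ≡ u

UniformlyRecurrent : InfWord → Set
UniformlyRecurrent w =
  (u : Word) → IsFactor w u →
  ∃ λ N → (j : ℕ) → IsFactorOf u (factor w j N)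

-- P^(k)_w(n) = m : the factors of w of length n fall into exactly m
-- k-Abelian classes, witnessed by m starting positions whose factors are
-- pairwise non-equivalent and such that every factor of length n is
-- k-Abelian equivalent to one of them.
AbComplexityIs : ℕ → InfWord → ℕ → ℕ → Set
AbComplexityIs k w n m =
  Σ (List ℕ) λ ps →
    length ps ≡ m ×
    AllPairs (λ i j → ¬ KAbEq k (factor w i n) (factor w j n)) ps ×
    ((i : ℕ) → Any (λ j → KAbEq k (factor w i n) (factor w j n)) ps)

-- The word w is the image of a binary Toeplitz word under b ↦ 0ᵏ b 0ᵏ. The Toeplitz
-- word carries β(ν) at position n, where ν is the number of trailing 1s of n in binary,
-- and β marks the levels d at which f, sampled at powers of 4, increases. A factor of
-- length ≤ k never meets two block centres, so the k-abelian class of a factor of w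
-- is fixed by its phase, its two partial blocks and the number of 1s in its full
-- blocks. In the Toeplitz word, two windows of length l differ in their number of
-- 1s by at most 1 + f l, since only levels below log l contribute and each rise of f
-- contributes one; this bounds the complexity by O(f). Conversely the rises before
-- level d can be realised simultaneously as a gap between two windows, and every
-- intermediate count then occurs, so the complexity is unbounded. Each factor recurs
-- with a period that is a power of two, which gives uniform recurrence.

module Submission where

open import Defs

open import Data.Bool using (Bool; true; false; if_then_else_)
open import Data.Empty using (⊥-elim)
open import Function using (_∘_)
open import Data.Parity.Base using (0ℙ; 1ℙ)
open import Data.List using (List; []; _∷_; length; _++_; replicate; take; drop; map; downFrom; deduplicate)
open import Data.List.Properties using (++-assoc; length-++; length-replicate; length-map; length-downFrom; length-removeAt′; ++-identityʳ)
open import Data.List.Membership.Propositional using (_∈_)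
open import Data.List.Membership.Propositional.Properties using (∈-downFrom⁺; ∈-downFrom⁻)
open import Data.List.Relation.Unary.All as All using (All; []; _∷_)
import Data.List.Relation.Unary.All.Properties as All
open import Data.List.Relation.Unary.AllPairs as AllPairs using (AllPairs; []; _∷_)
import Data.List.Relation.Unary.AllPairs.Properties as AllPairs
open import Data.List.Relation.Unary.Any as Any using (Any; here; there; _─_)
import Data.List.Relation.Unary.Any.Properties as Any
open import Data.List.Relation.Unary.Unique.DecSetoid.Properties using (deduplicate-!)
open import Data.List.Relation.Unary.Unique.Propositional.Properties using (downFrom⁺)
open import Data.Nat
open import Data.Nat.Properties
open import Data.Nat.DivMod
open import Data.Nat.Tactic.RingSolver using (solve-∀)
open import Data.Product using (∃; _×_; _,_; proj₁; proj₂)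
open import Data.Sum using (_⊎_; inj₁; inj₂)
open import Relation.Binary.PropositionalEquality
open import Relation.Nullary using (¬_; Dec; yes; no)
open import Relation.Binary.Definitions using (tri<; tri≈; tri>)
open import Relation.Nullary.Decidable using (map′; _×-dec_; _→-dec_)
open import Relation.Binary.Bundles using (DecSetoid)
open import Level using (0ℓ)
open import Relation.Nullary.Reflects using (ofʸ; ofⁿ)

bit : Bool → ℕ
bit true = 1
bit false = 0

bit≤1 : ∀ b → bit b ≤ 1
bit≤1 true = s≤s z≤n
bit≤1 false = z≤n

bit-injective : ∀ a b → bit a ≡ bit b → a ≡ b
bit-injective true true _ = refl
bit-injective false false _ = refl

bit<2 : ∀ b → bit b < 2
bit<2 b = s≤s (bit≤1 b)

double : ℕ → ℕ
double zero = zero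
double (suc t) = suc (suc (double t))

data EvenOdd : ℕ → Set where
  even : ∀ t → EvenOdd (double t)
  odd : ∀ t → EvenOdd (suc (double t))

evenOdd : ∀ n → EvenOdd n
evenOdd zero = even zero
evenOdd (suc zero) = odd zero
evenOdd (suc (suc n)) with evenOdd n
... | even t = even (suc t)
... | odd t = odd (suc t)

⌊double/2⌋≡ : ∀ t → ⌊ double t /2⌋ ≡ t
⌊double/2⌋≡ zero = refl
⌊double/2⌋≡ (suc t) = cong suc (⌊double/2⌋≡ t)

⌊1+double/2⌋≡ : ∀ t → ⌊ suc (double t) /2⌋ ≡ t
⌊1+double/2⌋≡ zero = refl
⌊1+double/2⌋≡ (suc t) = cong suc (⌊1+double/2⌋≡ t)

parity-double : ∀ t → parity (double t) ≡ 0ℙ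
parity-double zero = refl
parity-double (suc t) = parity-double t

parity-1+double : ∀ t → parity (suc (double t)) ≡ 1ℙ
parity-1+double zero = refl
parity-1+double (suc t) = parity-1+double t

⌊n/2⌋<n-odd : ∀ n → parity n ≡ 1ℙ → ⌊ n /2⌋ < n
⌊n/2⌋<n-odd (suc n) _ = ⌊n/2⌋<n n

double≡+ : ∀ t → double t ≡ t + t
double≡+ zero = refl
double≡+ (suc t) = cong suc (trans (cong suc (double≡+ t)) (sym (+-suc t t)))

double-+ : ∀ a b → double a + double b ≡ double (a + b)
double-+ zero b = refl
double-+ (suc a) b = cong (λ x → suc (suc x)) (double-+ a b)

double-mono : ∀ {a b} → a ≤ b → double a ≤ double b
double-mono z≤n = z≤n
double-mono (s≤s p) = s≤s (s≤s (double-mono p))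

n≤double : ∀ t → t ≤ double t
n≤double t = subst (t ≤_) (sym (double≡+ t)) (m≤m+n t t)

double⌊n/2⌋≤n : ∀ n → double ⌊ n /2⌋ ≤ n
double⌊n/2⌋≤n zero = z≤n
double⌊n/2⌋≤n (suc zero) = z≤n
double⌊n/2⌋≤n (suc (suc n)) = s≤s (s≤s (double⌊n/2⌋≤n n))

double-+* : ∀ t q P → double t + q * (2 * P) ≡ double (t + q * P)
double-+* t q P = begin
  double t + q * (2 * P)        ≡⟨ cong (_+ q * (2 * P)) (double≡+ t) ⟩
  (t + t) + q * (2 * P)         ≡⟨ ring t q P ⟩
  (t + q * P) + (t + q * P)     ≡⟨ sym (double≡+ (t + q * P)) ⟩
  double (t + q * P)            ∎
  where
  open ≡-Reasoning
  ring : ∀ t q P → (t + t) + q * (2 * P) ≡ (t + q * P) + (t + q * P)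
  ring = solve-∀

n<2^n : ∀ n → n < 2 ^ n
n<2^n zero = s≤s z≤n
n<2^n (suc n) = begin-strict
  suc n              ≡⟨ +-comm 1 n ⟩
  n + 1              <⟨ +-mono-<-≤ (n<2^n n) (m^n>0 2 n) ⟩
  2 ^ n + 2 ^ n      ≡⟨ cong (2 ^ n +_) (+-identityʳ (2 ^ n)) ⟨
  2 ^ suc n          ∎
  where open ≤-Reasoning

2*suc≡ : ∀ t → 2 * suc t ≡ suc (suc (double t))
2*suc≡ t rewrite double≡+ t = ring t
  where
  ring : ∀ t → 2 * suc t ≡ suc (suc (t + t))
  ring = solve-∀

pred-2P+q2P : ∀ P q → 1 ≤ P → pred (2 * P) + q * (2 * P) ≡ suc (double (pred P + q * P))
pred-2P+q2P (suc P′) q _ rewrite double≡+ (P′ + q * suc P′) = ring P′ q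
  where
  ring : ∀ P′ q → P′ + suc (P′ + 0) + q * (2 * suc P′) ≡ suc ((P′ + q * suc P′) + (P′ + q * suc P′))
  ring = solve-∀

module _ (L : ℕ) .{{_ : NonZero L}} where

  %-+* : ∀ a X → a < L → (a + X * L) % L ≡ a
  %-+* a X a<L = trans ([m+kn]%n≡m%n a X L) (m<n⇒m%n≡m a<L)

  /-+* : ∀ a X → a < L → (a + X * L) / L ≡ X
  /-+* a X a<L = begin
    (a + X * L) / L      ≡⟨ +-distrib-/ a (X * L) no-carry ⟩
    a / L + X * L / L    ≡⟨ cong₂ _+_ (m<n⇒m/n≡0 a<L) (m*n/n≡m X L) ⟩
    X                    ∎
    where
    open ≡-Reasoning
    no-carry : a % L + X * L % L < L
    no-carry = subst (_< L) (sym (trans (cong₂ _+_ (m<n⇒m%n≡m a<L) (m*n%n≡0 X L)) (+-identityʳ a))) a<L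

  divMod-unique : ∀ {a a′ X X′} → a < L → a′ < L → a + X * L ≡ a′ + X′ * L → a ≡ a′ × X ≡ X′
  divMod-unique {a} {a′} {X} {X′} a<L a′<L eq =
    trans (sym (%-+* a X a<L)) (trans (cong (_% L) eq) (%-+* a′ X′ a′<L)) ,
    trans (sym (/-+* a X a<L)) (trans (cong (_/ L) eq) (/-+* a′ X′ a′<L))

module _ {A : Set} where

  ∈-─ : ∀ {x y : A} ys (x∈ys : x ∈ ys) → y ∈ ys → y ≢ x → y ∈ (ys ─ x∈ys)
  ∈-─ (a ∷ ys) (here refl) (here refl) y≢x = ⊥-elim (y≢x refl)
  ∈-─ (a ∷ ys) (here refl) (there y∈ys) _ = y∈ys
  ∈-─ (a ∷ ys) (there x∈ys) (here y≡a) _ = here y≡a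
  ∈-─ (a ∷ ys) (there x∈ys) (there y∈ys) y≢x = there (∈-─ ys x∈ys y∈ys y≢x)

  distinct-⊆⇒length≤ : ∀ xs ys → AllPairs _≢_ xs → All (_∈ ys) xs → length xs ≤ length ys
  distinct-⊆⇒length≤ [] ys _ _ = z≤n
  distinct-⊆⇒length≤ (x ∷ xs) ys (x≢xs ∷ distinct) (x∈ys ∷ xs⊆ys) = begin
    suc (length xs)               ≤⟨ s≤s (distinct-⊆⇒length≤ xs (ys ─ x∈ys) distinct xs⊆ys─x) ⟩
    suc (length (ys ─ x∈ys))      ≡⟨ length-removeAt′ ys (Any.index x∈ys) ⟨
    length ys                     ∎
    where
    open ≤-Reasoning
    xs⊆ys─x : All (_∈ (ys ─ x∈ys)) xs
    xs⊆ys─x = All.zipWith (λ (x≢y , y∈ys) → ∈-─ ys x∈ys y∈ys (≢-sym x≢y)) (x≢xs , xs⊆ys)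

length≤-by-code : ∀ {R : ℕ → ℕ → Set} (code : ℕ → ℕ) C →
                  (∀ i → code i < C) → (∀ i j → code i ≡ code j → R i j) →
                  ∀ ps → AllPairs (λ i j → ¬ R i j) ps → length ps ≤ C
length≤-by-code code C code<C code≡⇒R ps unrelated = begin
  length ps                ≡⟨ length-map code ps ⟨
  length (map code ps)     ≤⟨ distinct-⊆⇒length≤ (map code ps) (downFrom C) distinct within ⟩
  length (downFrom C)      ≡⟨ length-downFrom C ⟩
  C                        ∎
  where
  open ≤-Reasoning
  distinct : AllPairs _≢_ (map code ps)
  distinct = AllPairs.map⁺ (AllPairs.map (λ {i} {j} ¬R eq → ¬R (code≡⇒R i j eq)) unrelated)
  within : All (_∈ downFrom C) (map code ps)
  within = All.map⁺ (All.universal (λ i → ∈-downFrom⁺ (code<C i)) ps)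

module _ (g : ℕ → ℕ)
         (step-up : ∀ i → g (suc i) ≤ suc (g i))
         (step-down : ∀ i → g i ≤ suc (g (suc i))) where

  intermediate-value-up : ∀ n i v → g i ≤ v → v ≤ g (i + n) → ∃ λ p → g p ≡ v
  intermediate-value-up zero i v below above = i , ≤-antisym below (subst (λ x → v ≤ g x) (+-identityʳ i) above)
  intermediate-value-up (suc n) i v below above with g i ≟ v
  ... | yes hit = i , hit
  ... | no miss = intermediate-value-up n (suc i) v (≤-trans (step-up i) (≤∧≢⇒< below miss))
                    (subst (λ x → v ≤ g x) (+-suc i n) above)

  intermediate-value-down : ∀ n i v → v ≤ g i → g (i + n) ≤ v → ∃ λ p → g p ≡ v
  intermediate-value-down zero i v above below = i , ≤-antisym (subst (λ x → g x ≤ v) (+-identityʳ i) below) above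
  intermediate-value-down (suc n) i v above below with g i ≟ v
  ... | yes hit = i , hit
  ... | no miss = intermediate-value-down n (suc i) v (≤-pred (≤-trans (≤∧≢⇒< above (miss ∘ sym)) (step-down i)))
                    (subst (λ x → g x ≤ v) (+-suc i n) below)

  intermediate-value : ∀ i i′ v → g i′ ≤ v → v ≤ g i → ∃ λ p → g p ≡ v
  intermediate-value i i′ v below above with i′ ≤? i
  ... | yes i′≤i = intermediate-value-up (i ∸ i′) i′ v below (subst (λ x → v ≤ g x) (sym (m+[n∸m]≡n i′≤i)) above)
  ... | no i′≰i = intermediate-value-down (i′ ∸ i) i v above
                    (subst (λ x → g x ≤ v) (sym (m+[n∸m]≡n (<⇒≤ (≰⇒> i′≰i)))) below)

factor-cong : ∀ (g h : InfWord) i j n → (∀ p → p < n → g (i + p) ≡ h (j + p)) → factor g i n ≡ factor h j n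
factor-cong g h i j zero _ = refl
factor-cong g h i j (suc n) agree = cong₂ _∷_
  (trans (cong g (sym (+-identityʳ i))) (trans (agree 0 (s≤s z≤n)) (cong h (+-identityʳ j))))
  (factor-cong g h (suc i) (suc j) n λ p p<n →
    trans (cong g (sym (+-suc i p))) (trans (agree (suc p) (s≤s p<n)) (cong h (+-suc j p))))

factor-+ : ∀ g i a b → factor g i (a + b) ≡ factor g i a ++ factor g (i + a) b
factor-+ g i zero b = cong (λ j → factor g j b) (sym (+-identityʳ i))
factor-+ g i (suc a) b = cong (g i ∷_) (trans (factor-+ g (suc i) a b)
                                         (cong (λ j → factor g (suc i) a ++ factor g j b) (sym (+-suc i a))))

length-factor : ∀ g i n → length (factor g i n) ≡ n
length-factor g i zero = refl
length-factor g i (suc n) = cong suc (length-factor g (suc i) n)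

take-factor : ∀ g i {a n} → a ≤ n → take a (factor g i n) ≡ factor g i a
take-factor g i {zero} _ = refl
take-factor g i {suc a} {suc n} (s≤s a≤n) = cong (g i ∷_) (take-factor g (suc i) a≤n)

take-drop-factor : ∀ g j N o a → o + a ≤ N → take a (drop o (factor g j N)) ≡ factor g (j + o) a
take-drop-factor g j N zero a a≤N = trans (take-factor g j a≤N) (cong (λ x → factor g x a) (sym (+-identityʳ j)))
take-drop-factor g j (suc N) (suc o) a (s≤s o+a≤N) =
  trans (take-drop-factor g (suc j) N o a o+a≤N) (cong (λ x → factor g x a) (sym (+-suc j o)))

factor-false : ∀ g i m → (∀ p → p < m → g (i + p) ≡ false) → factor g i m ≡ replicate m false
factor-false g i zero _ = refl
factor-false g i (suc m) all-false =
  cong₂ _∷_ (trans (cong g (sym (+-identityʳ i))) (all-false 0 (s≤s z≤n)))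
            (factor-false g (suc i) m λ p p<m → trans (cong g (sym (+-suc i p))) (all-false (suc p) (s≤s p<m)))

recurrent-if-periodic : ∀ (g : InfWord) (u : Word) i P → .{{NonZero P}} →
                        (∀ Q → factor g (i + Q * P) (length u) ≡ u) →
                        ∀ j → IsFactorOf u (factor g j (P + i + length u))
recurrent-if-periodic g u i P recurs j =
  o , subst (o + length u ≤_) (sym (length-factor g j N)) fits , found
  where
  N = P + i + length u
  Q = suc (j / P)
  o = i + Q * P ∸ j
  j<QP : j < Q * P
  j<QP = begin-strict
    j                    ≡⟨ m≡m%n+[m/n]*n j P ⟩
    j % P + j / P * P    <⟨ +-monoˡ-< (j / P * P) (m%n<n j P) ⟩
    Q * P                ∎
    where open ≤-Reasoning
  j≤i+QP : j ≤ i + Q * P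
  j≤i+QP = ≤-trans (<⇒≤ j<QP) (m≤n+m (Q * P) i)
  fits : o + length u ≤ N
  fits = +-monoˡ-≤ (length u) (m≤n+o⇒m∸n≤o (i + Q * P) j (begin
    i + Q * P            ≤⟨ +-monoʳ-≤ i (+-monoʳ-≤ P (m/n*n≤m j P)) ⟩
    i + (P + j)          ≡⟨ ring i P j ⟩
    j + (P + i)          ∎))
    where
    open ≤-Reasoning
    ring : ∀ i P j → i + (P + j) ≡ j + (P + i)
    ring = solve-∀
  found : take (length u) (drop o (factor g j N)) ≡ u
  found = begin
    take (length u) (drop o (factor g j N)) ≡⟨ take-drop-factor g j N o (length u) fits ⟩
    factor g (j + o) (length u)             ≡⟨ cong (λ x → factor g x (length u)) (m+[n∸m]≡n j≤i+QP) ⟩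
    factor g (i + Q * P) (length u)         ≡⟨ recurs Q ⟩
    u                                       ∎
    where open ≡-Reasoning

occStart : Word → Word → Word → ℕ
occStart x [] R = 0
occStart x (b ∷ u) R = (if isPrefix x (b ∷ u ++ R) then 1 else 0) + occStart x u R

occ-++ : ∀ x u R → occ x (u ++ R) ≡ occStart x u R + occ x R
occ-++ x [] R = refl
occ-++ x (b ∷ u) R rewrite occ-++ x u R =
  sym (+-assoc (if isPrefix x (b ∷ u ++ R) then 1 else 0) _ _)

occStart-++ : ∀ x u v R → occStart x (u ++ v) R ≡ occStart x u (v ++ R) + occStart x v R
occStart-++ x [] v R = refl
occStart-++ x (b ∷ u) v R rewrite occStart-++ x u v R | ++-assoc u v R =
  sym (+-assoc (if isPrefix x (b ∷ u ++ v ++ R) then 1 else 0) _ _)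

isPrefix-++ : ∀ x u R → length x ≤ length u → isPrefix x (u ++ R) ≡ isPrefix x u
isPrefix-++ [] u R _ = refl
isPrefix-++ (a ∷ x) (b ∷ u) R (s≤s x-fits-u) rewrite isPrefix-++ x u R x-fits-u = refl

occStart-truncate : ∀ x u z R → length x ≤ length z → occStart x u (z ++ R) ≡ occStart x u z
occStart-truncate x [] z R _ = refl
occStart-truncate x (b ∷ u) z R x-fits-z = cong₂ _+_ head (occStart-truncate x u z R x-fits-z)
  where
  x-fits : length x ≤ length (b ∷ u ++ z)
  x-fits = ≤-trans x-fits-z (≤-trans (m≤n+m (length z) (length u))
             (≤-trans (≤-reflexive (sym (length-++ u))) (n≤1+n _)))
  head : (if isPrefix x (b ∷ u ++ z ++ R) then 1 else 0) ≡ (if isPrefix x (b ∷ u ++ z) then 1 else 0)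
  head = cong (λ t → if t then 1 else 0)
              (trans (cong (isPrefix x) (sym (cong (b ∷_) (++-assoc u z R)))) (isPrefix-++ x (b ∷ u ++ z) R x-fits))

trues : List Bool → ℕ
trues [] = 0
trues (b ∷ bs) = bit b + trues bs

trues≤length : ∀ bs → trues bs ≤ length bs
trues≤length [] = z≤n
trues≤length (b ∷ bs) = +-mono-≤ (bit≤1 b) (trues≤length bs)

trues-++ : ∀ xs ys → trues (xs ++ ys) ≡ trues xs + trues ys
trues-++ [] ys = refl
trues-++ (x ∷ xs) ys = trans (cong (bit x +_) (trues-++ xs ys)) (sym (+-assoc (bit x) _ _))

trues-replicate-false : ∀ n → trues (replicate n false) ≡ 0
trues-replicate-false zero = refl
trues-replicate-false (suc n) = trues-replicate-false n

occ-true≡trues : ∀ u → occ (true ∷ []) u ≡ trues u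
occ-true≡trues [] = refl
occ-true≡trues (true ∷ u) = cong suc (occ-true≡trues u)
occ-true≡trues (false ∷ u) = occ-true≡trues u

∀-short? : ∀ k {P : Word → Set} → (∀ x → Dec (P x)) → Dec (∀ x → length x ≤ k → P x)
∀-short? zero {P} P? = map′ (λ p → λ { [] _ → p ; (_ ∷ _) () }) (λ h → h [] z≤n) (P? [])
∀-short? (suc k) {P} P? =
  map′ to from (P? [] ×-dec ∀-short? k (λ x → P? (true ∷ x)) ×-dec ∀-short? k (λ x → P? (false ∷ x)))
  where
  Short : ℕ → (Word → Set) → Set
  Short k Q = ∀ x → length x ≤ k → Q x
  to : P [] × Short k (λ x → P (true ∷ x)) × Short k (λ x → P (false ∷ x)) → Short (suc k) P
  to (p , _ , _) [] _ = p
  to (_ , pt , _) (true ∷ x) (s≤s short) = pt x short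
  to (_ , _ , pf) (false ∷ x) (s≤s short) = pf x short
  from : Short (suc k) P → P [] × Short k (λ x → P (true ∷ x)) × Short k (λ x → P (false ∷ x))
  from h = h [] z≤n , (λ x short → h (true ∷ x) (s≤s short)) , (λ x short → h (false ∷ x) (s≤s short))

KAbEq? : ∀ k u v → Dec (KAbEq k u v)
KAbEq? k u v = map′ (λ h x nonempty short → h x short nonempty)
                    (λ h x short nonempty → h x nonempty short)
                    (∀-short? k (λ x → (1 ≤? length x) →-dec (occ x u ≟ occ x v)))

factorClasses : ℕ → InfWord → ℕ → DecSetoid 0ℓ 0ℓ
factorClasses k w n = record
  { Carrier = ℕ
  ; _≈_ = λ i j → KAbEq k (factor w i n) (factor w j n)
  ; isDecEquivalence = record
    { isEquivalence = record
      { refl = λ _ _ _ → refl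
      ; sym = λ i≈j x nonempty short → sym (i≈j x nonempty short)
      ; trans = λ i≈j j≈l x nonempty short → trans (i≈j x nonempty short) (j≈l x nonempty short)
      }
    ; _≟_ = λ i j → KAbEq? k (factor w i n) (factor w j n)
    }
  }

abComplexity-of-cover : ∀ k w n M → (∀ i → ∃ λ j → j < M × factor w i n ≡ factor w j n) →
                        ∃ λ m → AbComplexityIs k w n m
abComplexity-of-cover k w n M cover = length reps , reps , refl , deduplicate-! (factorClasses k w n) (downFrom M) , covered
  where
  open DecSetoid (factorClasses k w n) using (_≈_) renaming (_≟_ to _≈?_; refl to ≈-refl; sym to ≈-sym; trans to ≈-trans)
  reps : List ℕ
  reps = deduplicate _≈?_ (downFrom M)
  covered : ∀ i → Any (i ≈_) reps
  covered i with cover i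
  ... | j , j<M , same =
    Any.deduplicate⁺ _≈?_ (λ y≈x i≈x → ≈-trans i≈x (≈-sym y≈x))
      (Any.map (λ { refl → subst (λ u → KAbEq k (factor w i n) u) same ≈-refl }) (∈-downFrom⁺ j<M))

module Blocks (k : ℕ) where

  zeros : Word
  zeros = replicate k false

  block : Bool → Word
  block b = zeros ++ b ∷ zeros

  blocks : List Bool → Word
  blocks [] = []
  blocks (b ∷ bs) = block b ++ blocks bs

  trues-blocks : ∀ bs → trues (blocks bs) ≡ trues bs
  trues-blocks [] = refl
  trues-blocks (b ∷ bs) = trans (trues-++ (block b) (blocks bs)) (cong₂ _+_ trues-block (trues-blocks bs))
    where
    trues-block : trues (block b) ≡ bit b
    trues-block rewrite trues-++ zeros (b ∷ zeros) | trues-replicate-false k = +-identityʳ (bit b)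

  -- A factor of length ≤ k starting in a block never reaches the next centre.
  module _ (x : Word) (x-short : length x ≤ k) where

    x-fits : length x ≤ length zeros
    x-fits = ≤-trans x-short (≤-reflexive (sym (length-replicate k)))

    centre : Bool → ℕ
    centre b = occStart x (zeros ++ b ∷ []) zeros

    seam : ℕ
    seam = occStart x zeros zeros

    occ-block : ∀ b R → occ x (block b ++ R) ≡ centre b + occStart x zeros R + occ x R
    occ-block b R = begin
      occ x (block b ++ R)                                             ≡⟨ occ-++ x (block b) R ⟩
      occStart x (block b) R + occ x R                                 ≡⟨ cong (λ u → occStart x u R + occ x R) (sym (++-assoc zeros (b ∷ []) zeros)) ⟩
      occStart x ((zeros ++ b ∷ []) ++ zeros) R + occ x R              ≡⟨ cong (_+ occ x R) (occStart-++ x (zeros ++ b ∷ []) zeros R) ⟩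
      occStart x (zeros ++ b ∷ []) (zeros ++ R) + occStart x zeros R + occ x R
        ≡⟨ cong (λ y → y + occStart x zeros R + occ x R) (occStart-truncate x (zeros ++ b ∷ []) zeros R x-fits) ⟩
      centre b + occStart x zeros R + occ x R                          ∎
      where open ≡-Reasoning

    occStart-before-block : ∀ u b R → occStart x u (block b ++ R) ≡ occStart x u zeros
    occStart-before-block u b R =
      trans (cong (occStart x u) (++-assoc zeros (b ∷ zeros) R)) (occStart-truncate x u zeros _ x-fits)

    seamAfter : ℕ → Word → ℕ
    seamAfter zero t = occStart x zeros t
    seamAfter (suc n) t = seam

    occStart-zeros-blocks : ∀ bs t → occStart x zeros (blocks bs ++ t) ≡ seamAfter (length bs) t
    occStart-zeros-blocks [] t = refl
    occStart-zeros-blocks (c ∷ cs) t =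
      trans (cong (occStart x zeros) (++-assoc (block c) (blocks cs) t))
            (occStart-before-block zeros c (blocks cs ++ t))

    centres : List Bool → ℕ
    centres [] = 0
    centres (b ∷ bs) = centre b + centres bs

    seams : ℕ → Word → ℕ
    seams zero t = 0
    seams (suc n) t = seamAfter n t + seams n t

    occ-blocks : ∀ bs t → occ x (blocks bs ++ t) ≡ centres bs + seams (length bs) t + occ x t
    occ-blocks [] t = refl
    occ-blocks (b ∷ bs) t = begin
      occ x ((block b ++ blocks bs) ++ t)       ≡⟨ cong (occ x) (++-assoc (block b) (blocks bs) t) ⟩
      occ x (block b ++ (blocks bs ++ t))       ≡⟨ occ-block b (blocks bs ++ t) ⟩
      centre b + occStart x zeros (blocks bs ++ t) + occ x (blocks bs ++ t)
        ≡⟨ cong₂ (λ a c → centre b + a + c) (occStart-zeros-blocks bs t) (occ-blocks bs t) ⟩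
      centre b + seamAfter (length bs) t + (centres bs + seams (length bs) t + occ x t)
        ≡⟨ ring (centre b) (seamAfter (length bs) t) (centres bs) (seams (length bs) t) (occ x t) ⟩
      centre b + centres bs + seams (length (b ∷ bs)) t + occ x t ∎
      where
      open ≡-Reasoning
      ring : ∀ a b c d e → a + b + (c + d + e) ≡ a + c + (b + d) + e
      ring = solve-∀

    centres≡ : ∀ bs → centres bs ≡ trues bs * centre true + (length bs ∸ trues bs) * centre false
    centres≡ [] = refl
    centres≡ (true ∷ bs) rewrite centres≡ bs = sym (+-assoc (centre true) _ _)
    centres≡ (false ∷ bs) rewrite centres≡ bs | +-∸-assoc 1 (trues≤length bs) =
      ring (centre false) (trues bs * centre true) ((length bs ∸ trues bs) * centre false)
      where
      ring : ∀ a b c → a + (b + c) ≡ b + (a + c)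
      ring = solve-∀

    occ-blocks-invariant : ∀ bs bs′ t → length bs ≡ length bs′ → trues bs ≡ trues bs′ →
                           occ x (blocks bs ++ t) ≡ occ x (blocks bs′ ++ t)
    occ-blocks-invariant bs bs′ t same-length same-trues
      rewrite occ-blocks bs t | occ-blocks bs′ t | centres≡ bs | centres≡ bs′
            | same-length | same-trues = refl

    occStart-blocks-invariant : ∀ s bs bs′ t → length bs ≡ length bs′ →
                                occStart x s (blocks bs ++ t) ≡ occStart x s (blocks bs′ ++ t)
    occStart-blocks-invariant s [] [] t _ = refl
    occStart-blocks-invariant s (b ∷ bs) (b′ ∷ bs′) t _ = begin
      occStart x s ((block b ++ blocks bs) ++ t)   ≡⟨ cong (occStart x s) (++-assoc (block b) (blocks bs) t) ⟩
      occStart x s (block b ++ blocks bs ++ t)     ≡⟨ occStart-before-block s b (blocks bs ++ t) ⟩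
      occStart x s zeros                           ≡⟨ occStart-before-block s b′ (blocks bs′ ++ t) ⟨
      occStart x s (block b′ ++ blocks bs′ ++ t)   ≡⟨ cong (occStart x s) (++-assoc (block b′) (blocks bs′) t) ⟨
      occStart x s ((block b′ ++ blocks bs′) ++ t) ∎
      where open ≡-Reasoning

    occ-framed-blocks-invariant : ∀ s bs bs′ t → length bs ≡ length bs′ → trues bs ≡ trues bs′ →
                                  occ x (s ++ blocks bs ++ t) ≡ occ x (s ++ blocks bs′ ++ t)
    occ-framed-blocks-invariant s bs bs′ t same-length same-trues
      rewrite occ-++ x s (blocks bs ++ t) | occ-++ x s (blocks bs′ ++ t)
            | occ-blocks-invariant bs bs′ t same-length same-trues
            | occStart-blocks-invariant s bs bs′ t same-length = refl

module Toeplitz (β : ℕ → Bool) where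

  -- toeplitz d (2t) = β d and toeplitz d (2t+1) = toeplitz (d + 1) t; the fuel only ensures termination.

  toeplitzᶠ : ℕ → ℕ → ℕ → Bool
  toeplitzᶠ zero d n = false
  toeplitzᶠ (suc fuel) d n with parity n
  ... | 0ℙ = β d
  ... | 1ℙ = toeplitzᶠ fuel (suc d) ⌊ n /2⌋

  toeplitzᶠ-fuel : ∀ fuel fuel′ d n → n < fuel → n < fuel′ →
                   toeplitzᶠ fuel d n ≡ toeplitzᶠ fuel′ d n
  toeplitzᶠ-fuel (suc fuel) (suc fuel′) d n (s≤s n≤fuel) (s≤s n≤fuel′) with parity n in odd
  ... | 0ℙ = refl
  ... | 1ℙ = toeplitzᶠ-fuel fuel fuel′ (suc d) ⌊ n /2⌋
               (<-≤-trans (⌊n/2⌋<n-odd n odd) n≤fuel) (<-≤-trans (⌊n/2⌋<n-odd n odd) n≤fuel′)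

  toeplitz : ℕ → ℕ → Bool
  toeplitz d n = toeplitzᶠ (suc n) d n

  toeplitz-even : ∀ d t → toeplitz d (double t) ≡ β d
  toeplitz-even d t rewrite parity-double t = refl

  toeplitz-odd : ∀ d t → toeplitz d (suc (double t)) ≡ toeplitz (suc d) t
  toeplitz-odd d t rewrite parity-1+double t | ⌊1+double/2⌋≡ t =
    toeplitzᶠ-fuel (suc (double t)) (suc t) (suc d) t (s≤s (n≤double t)) ≤-refl

  ones : ℕ → ℕ → ℕ → ℕ
  ones d i zero = 0
  ones d i (suc l) = bit (toeplitz d i) + ones d (suc i) l

  ones≤length : ∀ d i l → ones d i l ≤ l
  ones≤length d i zero = z≤n
  ones≤length d i (suc l) = +-mono-≤ (bit≤1 (toeplitz d i)) (ones≤length d (suc i) l)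

  ones-suc : ∀ d i l → ones d i (suc l) ≡ ones d i l + bit (toeplitz d (i + l))
  ones-suc d i zero rewrite +-identityʳ i | +-identityʳ (bit (toeplitz d i)) = refl
  ones-suc d i (suc l) rewrite ones-suc d (suc i) l | +-suc i l =
    sym (+-assoc (bit (toeplitz d i)) (ones d (suc i) l) _)

  ones≤ones-suc : ∀ d i l → ones d i l ≤ ones d i (suc l)
  ones≤ones-suc d i l rewrite ones-suc d i l = m≤m+n _ _

  ones-step-up : ∀ d l i → ones d (suc i) l ≤ suc (ones d i l)
  ones-step-up d l i = begin
    ones d (suc i) l                          ≤⟨ m≤n+m _ (bit (toeplitz d i)) ⟩
    ones d i (suc l)                          ≡⟨ ones-suc d i l ⟩
    ones d i l + bit (toeplitz d (i + l))     ≤⟨ +-monoʳ-≤ (ones d i l) (bit≤1 _) ⟩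
    ones d i l + 1                            ≡⟨ +-comm (ones d i l) 1 ⟩
    suc (ones d i l)                          ∎
    where open ≤-Reasoning

  ones-step-down : ∀ d l i → ones d i l ≤ suc (ones d (suc i) l)
  ones-step-down d l i = ≤-trans (ones≤ones-suc d i l) (+-monoˡ-≤ (ones d (suc i) l) (bit≤1 (toeplitz d i)))

  ones-pair : ∀ d i → bit (toeplitz d i) + bit (toeplitz d (suc i))
                      ≡ bit (β d) + bit (toeplitz (suc d) ⌊ i /2⌋)
  ones-pair d i with evenOdd i
  ... | even t rewrite toeplitz-even d t | toeplitz-odd d t | ⌊double/2⌋≡ t = refl
  ... | odd t rewrite toeplitz-odd d t | ⌊1+double/2⌋≡ t | toeplitz-even d (suc t) =
    +-comm (bit (toeplitz (suc d) t)) (bit (β d))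

  ones-double : ∀ d i l → ones d i (double l) ≡ bit (β d) * l + ones (suc d) ⌊ i /2⌋ l
  ones-double d i zero = sym (trans (+-identityʳ (bit (β d) * 0)) (*-zeroʳ (bit (β d))))
  ones-double d i (suc l) = begin
    bit (toeplitz d i) + (bit (toeplitz d (suc i)) + ones d (suc (suc i)) (double l))
      ≡⟨ sym (+-assoc (bit (toeplitz d i)) _ _) ⟩
    (bit (toeplitz d i) + bit (toeplitz d (suc i))) + ones d (suc (suc i)) (double l)
      ≡⟨ cong₂ _+_ (ones-pair d i) (ones-double d (suc (suc i)) l) ⟩
    (b + x) + (b * l + ones (suc d) (suc ⌊ i /2⌋) l)
      ≡⟨ ring b x l (ones (suc d) (suc ⌊ i /2⌋) l) ⟩
    b * suc l + (x + ones (suc d) (suc ⌊ i /2⌋) l) ∎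
    where
    open ≡-Reasoning
    b = bit (β d)
    x = bit (toeplitz (suc d) ⌊ i /2⌋)
    ring : ∀ b x l y → (b + x) + (b * l + y) ≡ b * suc l + (x + y)
    ring = solve-∀

  ones-even-odd : ∀ d t l → ones d (double t) (suc (double l))
                            ≡ bit (β d) * l + bit (β d) + ones (suc d) t l
  ones-even-odd d t l
    rewrite ones-suc d (double t) (double l) | ones-double d (double t) l | ⌊double/2⌋≡ t
          | double-+ t l | toeplitz-even d (t + l) = ring (bit (β d)) l (ones (suc d) t l)
    where
    ring : ∀ b l y → b * l + y + b ≡ b * l + b + y
    ring = solve-∀

  ones-odd-odd : ∀ d t l → ones d (suc (double t)) (suc (double l))
                           ≡ bit (β d) * l + ones (suc d) t (suc l)
  ones-odd-odd d t l
    rewrite ones-suc d (suc (double t)) (double l) | ones-double d (suc (double t)) l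
          | ⌊1+double/2⌋≡ t | double-+ t l | toeplitz-odd d (t + l) | ones-suc (suc d) t l =
    +-assoc (bit (β d) * l) _ _

  excessᶠ : ℕ → ℕ → ℕ → ℕ
  excessᶠ zero d l = suc l
  excessᶠ (suc fuel) d zero = 1
  excessᶠ (suc fuel) d (suc l) = bit (β d) + excessᶠ fuel (suc d) ⌊ suc l /2⌋

  ones-excess : ∀ fuel d l i i′ → ones d i (suc l) ≤ ones d i′ l + excessᶠ fuel d l
  ones-excess zero d l i i′ = ≤-trans (ones≤length d i (suc l)) (m≤n+m (suc l) _)
  ones-excess (suc fuel) d l i i′ with evenOdd l
  ... | even zero = +-monoˡ-≤ 0 (bit≤1 (toeplitz d i))
  ... | even (suc l₀) rewrite ⌊double/2⌋≡ l₀ = begin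
    ones d i (suc (double (suc l₀)))                        ≤⟨ ones≤ones-suc d i (suc (double (suc l₀))) ⟩
    ones d i (double (suc (suc l₀)))                        ≡⟨ ones-double d i (suc (suc l₀)) ⟩
    b * suc (suc l₀) + ones (suc d) ⌊ i /2⌋ (suc (suc l₀))
      ≤⟨ +-monoʳ-≤ (b * suc (suc l₀)) (ones-excess fuel (suc d) (suc l₀) ⌊ i /2⌋ ⌊ i′ /2⌋) ⟩
    b * suc (suc l₀) + (ones (suc d) ⌊ i′ /2⌋ (suc l₀) + h) ≡⟨ ring b (suc l₀) _ h ⟩
    (b * suc l₀ + ones (suc d) ⌊ i′ /2⌋ (suc l₀)) + (b + h) ≡⟨ cong (_+ (b + h)) (ones-double d i′ (suc l₀)) ⟨
    ones d i′ (double (suc l₀)) + (b + h)                   ∎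
    where
    open ≤-Reasoning
    b = bit (β d)
    h = excessᶠ fuel (suc d) (suc l₀)
    ring : ∀ b l x h → b * suc l + (x + h) ≡ (b * l + x) + (b + h)
    ring = solve-∀
  ... | odd l₀ rewrite ⌊1+double/2⌋≡ l₀ = begin
    ones d i (double (suc l₀))                              ≡⟨ ones-double d i (suc l₀) ⟩
    b * suc l₀ + ones (suc d) ⌊ i /2⌋ (suc l₀)
      ≤⟨ +-monoʳ-≤ (b * suc l₀) (ones-excess fuel (suc d) l₀ ⌊ i /2⌋ ⌊ i′ /2⌋) ⟩
    b * suc l₀ + (ones (suc d) ⌊ i′ /2⌋ l₀ + h)             ≡⟨ ring b l₀ _ h ⟩
    (b * l₀ + ones (suc d) ⌊ i′ /2⌋ l₀) + (b + h)           ≡⟨ cong (_+ (b + h)) (ones-double d i′ l₀) ⟨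
    ones d i′ (double l₀) + (b + h)                         ≤⟨ +-monoˡ-≤ (b + h) (ones≤ones-suc d i′ (double l₀)) ⟩
    ones d i′ (suc (double l₀)) + (b + h)                   ∎
    where
    open ≤-Reasoning
    b = bit (β d)
    h = excessᶠ fuel (suc d) l₀
    ring : ∀ b l x h → b * suc l + (x + h) ≡ (b * l + x) + (b + h)
    ring = solve-∀

  Gap : ℕ → ℕ → ℕ → Set
  Gap d l g = ∃ λ i → ∃ λ i′ → ones d i′ l + g ≤ ones d i l

  Gap⁺ : ℕ → ℕ → ℕ → Set
  Gap⁺ d l g = ∃ λ i → ∃ λ i′ → ones d i′ l + g ≤ ones d i (suc l)

  gap-double : ∀ d l g → Gap (suc d) l g → Gap d (double l) g
  gap-double d l g (i , i′ , gap) = double i , double i′ , gap′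
    where
    gap′ : ones d (double i′) (double l) + g ≤ ones d (double i) (double l)
    gap′ rewrite ones-double d (double i′) l | ones-double d (double i) l
               | ⌊double/2⌋≡ i | ⌊double/2⌋≡ i′ =
      ≤-trans (≤-reflexive (+-assoc (bit (β d) * l) _ g)) (+-monoʳ-≤ (bit (β d) * l) gap)

  gap-double-true : ∀ d l g → β d ≡ true → Gap (suc d) l g → Gap⁺ d (double l) (suc g)
  gap-double-true d l g βd (i , i′ , gap) = double i , double i′ , gap′
    where
    ring : ∀ l x g → 1 * l + x + suc g ≡ 1 * l + 1 + (x + g)
    ring = solve-∀
    gap′ : ones d (double i′) (double l) + suc g ≤ ones d (double i) (suc (double l))
    gap′ rewrite ones-double d (double i′) l | ones-even-odd d i l | ⌊double/2⌋≡ i′ | βd =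
      ≤-trans (≤-reflexive (ring l (ones (suc d) i′ l) g)) (+-monoʳ-≤ (1 * l + 1) gap)

  gap⁺-double-false : ∀ d l g → β d ≡ false → Gap⁺ (suc d) l g → Gap d (suc (double l)) g
  gap⁺-double-false d l g βd (i , i′ , gap) = suc (double i) , double i′ , gap′
    where
    gap′ : ones d (double i′) (suc (double l)) + g ≤ ones d (suc (double i)) (suc (double l))
    gap′ rewrite ones-even-odd d i′ l | ones-odd-odd d i l | βd = gap

  toeplitz-periodic : ∀ K d q n → suc n < 2 ^ K → toeplitz d (n + q * 2 ^ K) ≡ toeplitz d n
  toeplitz-periodic zero d q n (s≤s ())
  toeplitz-periodic (suc K) d q n n<2^K with evenOdd n
  ... | even t = begin
    toeplitz d (double t + q * 2 ^ suc K) ≡⟨ cong (toeplitz d) (double-+* t q (2 ^ K)) ⟩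
    toeplitz d (double (t + q * 2 ^ K))   ≡⟨ toeplitz-even d (t + q * 2 ^ K) ⟩
    β d                                   ≡⟨ toeplitz-even d t ⟨
    toeplitz d (double t)                 ∎
    where open ≡-Reasoning
  ... | odd t = begin
    toeplitz d (suc (double t) + q * 2 ^ suc K) ≡⟨ cong (toeplitz d) (cong suc (double-+* t q (2 ^ K))) ⟩
    toeplitz d (suc (double (t + q * 2 ^ K)))   ≡⟨ toeplitz-odd d (t + q * 2 ^ K) ⟩
    toeplitz (suc d) (t + q * 2 ^ K)            ≡⟨ toeplitz-periodic K (suc d) q t t<2^K ⟩
    toeplitz (suc d) t                          ≡⟨ toeplitz-odd d t ⟨
    toeplitz d (suc (double t))                 ∎
    where
    open ≡-Reasoning
    t<2^K : suc t < 2 ^ K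
    t<2^K = *-cancelˡ-< 2 (suc t) (2 ^ K) (subst (_< 2 * 2 ^ K) (sym (2*suc≡ t)) n<2^K)

  toeplitz-hole : ∀ K d q → toeplitz d (pred (2 ^ K) + q * 2 ^ K) ≡ toeplitz (d + K) q
  toeplitz-hole zero d q = cong₂ toeplitz (sym (+-identityʳ d)) (*-identityʳ q)
  toeplitz-hole (suc K) d q = begin
    toeplitz d (pred (2 ^ suc K) + q * 2 ^ suc K)   ≡⟨ cong (toeplitz d) (pred-2P+q2P (2 ^ K) q (m^n>0 2 K)) ⟩
    toeplitz d (suc (double (pred (2 ^ K) + q * 2 ^ K))) ≡⟨ toeplitz-odd d (pred (2 ^ K) + q * 2 ^ K) ⟩
    toeplitz (suc d) (pred (2 ^ K) + q * 2 ^ K)     ≡⟨ toeplitz-hole K (suc d) q ⟩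
    toeplitz (suc d + K) q                          ≡⟨ cong (λ x → toeplitz x q) (+-suc d K) ⟨
    toeplitz (d + suc K) q                          ∎
    where open ≡-Reasoning

  toeplitz-pred-2^ : ∀ d t → toeplitz d (pred (2 ^ t)) ≡ β (d + t)
  toeplitz-pred-2^ d t =
    trans (cong (toeplitz d) (sym (+-identityʳ (pred (2 ^ t))))) (trans (toeplitz-hole t d 0) (toeplitz-even (d + t) 0))

  -- Below 2^m + m, a window only sees the period-2^m part and one hole, filled by level d + m.
  toeplitz-determined-by-hole : ∀ d m Q Q₀ → toeplitz (d + m) Q ≡ toeplitz (d + m) Q₀ →
                                ∀ x → x < 2 ^ m + m → toeplitz d (x + Q * 2 ^ m) ≡ toeplitz d (x + Q₀ * 2 ^ m)
  toeplitz-determined-by-hole d m Q Q₀ same-hole x x<P+m with <-cmp (suc x) (2 ^ m)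
  ... | tri< 1+x<P _ _ = trans (toeplitz-periodic m d Q x 1+x<P) (sym (toeplitz-periodic m d Q₀ x 1+x<P))
  ... | tri≈ _ 1+x≡P _ = begin
    toeplitz d (x + Q * 2 ^ m)               ≡⟨ cong (λ y → toeplitz d (y + Q * 2 ^ m)) x≡ ⟩
    toeplitz d (pred (2 ^ m) + Q * 2 ^ m)    ≡⟨ toeplitz-hole m d Q ⟩
    toeplitz (d + m) Q                       ≡⟨ same-hole ⟩
    toeplitz (d + m) Q₀                      ≡⟨ toeplitz-hole m d Q₀ ⟨
    toeplitz d (pred (2 ^ m) + Q₀ * 2 ^ m)   ≡⟨ cong (λ y → toeplitz d (y + Q₀ * 2 ^ m)) x≡ ⟨
    toeplitz d (x + Q₀ * 2 ^ m)              ∎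
    where
    open ≡-Reasoning
    x≡ : x ≡ pred (2 ^ m)
    x≡ = cong pred 1+x≡P
  ... | tri> _ _ P<1+x = begin
    toeplitz d (x + Q * 2 ^ m)               ≡⟨ cong (toeplitz d) (shift Q) ⟩
    toeplitz d (p + suc Q * 2 ^ m)           ≡⟨ toeplitz-periodic m d (suc Q) p 1+p<P ⟩
    toeplitz d p                             ≡⟨ toeplitz-periodic m d (suc Q₀) p 1+p<P ⟨
    toeplitz d (p + suc Q₀ * 2 ^ m)          ≡⟨ cong (toeplitz d) (shift Q₀) ⟨
    toeplitz d (x + Q₀ * 2 ^ m)              ∎
    where
    open ≡-Reasoning
    p = x ∸ 2 ^ m
    x≡ : x ≡ 2 ^ m + p
    x≡ = sym (m+[n∸m]≡n (≤-pred P<1+x))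
    1+p<P : suc p < 2 ^ m
    1+p<P = ≤-trans (s≤s (+-cancelˡ-< (2 ^ m) p m (subst (_< 2 ^ m + m) x≡ x<P+m))) (n<2^n m)
    shift : ∀ Q → x + Q * 2 ^ m ≡ p + suc Q * 2 ^ m
    shift Q = trans (cong (_+ Q * 2 ^ m) x≡) (ring (2 ^ m) p (Q * 2 ^ m))
      where
      ring : ∀ a b c → a + b + c ≡ b + (a + c)
      ring = solve-∀

  module _ (both : ∀ d b → ∃ λ t → β (d + t) ≡ b) where

    toeplitz-cover : ∀ d m → ∃ λ M → ∀ a → ∃ λ a₀ → a₀ < M × (∀ p → p < m → toeplitz d (a + p) ≡ toeplitz d (a₀ + p))
    toeplitz-cover d m = suc (Q₀ + Q₁) * P , cover
      where
      P = 2 ^ m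
      instance
        P≢0 : NonZero P
        P≢0 = m^n≢0 2 m
      Q₁ Q₀ : ℕ
      Q₁ = pred (2 ^ proj₁ (both (d + m) true))
      Q₀ = pred (2 ^ proj₁ (both (d + m) false))
      hole-value : ∀ b → ∃ λ Q′ → Q′ ≤ Q₀ + Q₁ × toeplitz (d + m) Q′ ≡ b
      hole-value true = Q₁ , m≤n+m Q₁ Q₀ , trans (toeplitz-pred-2^ (d + m) _) (proj₂ (both (d + m) true))
      hole-value false = Q₀ , m≤m+n Q₀ Q₁ , trans (toeplitz-pred-2^ (d + m) _) (proj₂ (both (d + m) false))
      cover : ∀ a → ∃ λ a₀ → a₀ < suc (Q₀ + Q₁) * P × (∀ p → p < m → toeplitz d (a + p) ≡ toeplitz d (a₀ + p))
      cover a with hole-value (toeplitz (d + m) (a / P))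
      ... | Q′ , Q′≤ , same-hole = a % P + Q′ * P , a₀<M , agree
        where
        ring : ∀ a b c → a + b + c ≡ a + c + b
        ring = solve-∀
        a₀<M : a % P + Q′ * P < suc (Q₀ + Q₁) * P
        a₀<M = ≤-trans (+-monoˡ-< (Q′ * P) (m%n<n a P)) (*-monoˡ-≤ P (s≤s Q′≤))
        agree : ∀ p → p < m → toeplitz d (a + p) ≡ toeplitz d (a % P + Q′ * P + p)
        agree p p<m = begin
          toeplitz d (a + p)                         ≡⟨ cong (λ y → toeplitz d (y + p)) (m≡m%n+[m/n]*n a P) ⟩
          toeplitz d (a % P + a / P * P + p)         ≡⟨ cong (toeplitz d) (ring (a % P) _ p) ⟩
          toeplitz d (a % P + p + a / P * P)         ≡⟨ toeplitz-determined-by-hole d m (a / P) Q′ (sym same-hole) (a % P + p)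
                                                         (+-mono-< (m%n<n a P) p<m) ⟩
          toeplitz d (a % P + p + Q′ * P)            ≡⟨ cong (toeplitz d) (ring (a % P) _ p) ⟨
          toeplitz d (a % P + Q′ * P + p)            ∎
          where open ≡-Reasoning

module Rises (f : ℕ → ℕ)
             (f-mono : (m n : ℕ) → 1 ≤ m → m ≤ n → f m ≤ f n)
             (f-unbounded : (B : ℕ) → ∃ λ n → 1 ≤ n × B < f n) where

  -- sample (2e+1) = sample (2e+2), so odd levels never rise and rises are isolated.
  sample : ℕ → ℕ
  sample zero = f 1
  sample (suc d) = f (2 ^ double ⌊ d /2⌋)

  rises : ℕ → Bool
  rises d = sample d <ᵇ sample (suc d)

  open Toeplitz rises public

  f-2^-mono : ∀ {a b} → a ≤ b → f (2 ^ a) ≤ f (2 ^ b)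
  f-2^-mono {a} a≤b = f-mono _ _ (m^n>0 2 a) (^-monoʳ-≤ 2 a≤b)

  sample-step : ∀ d → sample d ≤ sample (suc d)
  sample-step zero = ≤-refl
  sample-step (suc d) = f-2^-mono (double-mono (⌊n/2⌋-mono (n≤1+n d)))

  sample-mono : ∀ {a b} → a ≤ b → sample a ≤ sample b
  sample-mono {a} a≤b rewrite sym (m+[n∸m]≡n a≤b) = go (_ ∸ a)
    where
    go : ∀ m → sample a ≤ sample (a + m)
    go zero rewrite +-identityʳ a = ≤-refl
    go (suc m) rewrite +-suc a m = ≤-trans (go m) (sample-step (a + m))

  rise-bit+sample≤ : ∀ d → bit (rises d) + sample d ≤ sample (suc d)
  rise-bit+sample≤ d with rises d | <ᵇ-reflects-< (sample d) (sample (suc d))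
  ... | true | ofʸ lt = lt
  ... | false | ofⁿ _ = sample-step d

  sample-suc≤ : ∀ d → sample (suc d) ≤ f (2 ^ d)
  sample-suc≤ d = f-2^-mono (double⌊n/2⌋≤n d)

  excessᶠ-zero : ∀ fuel d → excessᶠ fuel d 0 ≡ 1
  excessᶠ-zero zero d = refl
  excessᶠ-zero (suc fuel) d = refl

  -- Every rise counted by the excess is paid for by an increase of sample.
  excess+sample≤ : ∀ fuel d l → 1 ≤ l → l ≤ fuel → excessᶠ fuel d l + sample d ≤ suc (f (l * 2 ^ d))
  excess+sample≤ (suc fuel) d (suc l) _ (s≤s l≤fuel) with ⌊ suc l /2⌋ in half≡
  ... | zero rewrite excessᶠ-zero fuel (suc d) = begin
    bit (rises d) + 1 + sample d   ≡⟨ cong (_+ sample d) (+-comm (bit (rises d)) 1) ⟩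
    suc (bit (rises d) + sample d) ≤⟨ s≤s (rise-bit+sample≤ d) ⟩
    suc (sample (suc d))           ≤⟨ s≤s (sample-suc≤ d) ⟩
    suc (f (2 ^ d))                ≤⟨ s≤s (f-mono _ _ (m^n>0 2 d) (m≤n*m (2 ^ d) (suc l))) ⟩
    suc (f (suc l * 2 ^ d))        ∎
    where open ≤-Reasoning
  ... | suc h = begin
    bit (rises d) + e + sample d   ≡⟨ ring (bit (rises d)) e (sample d) ⟩
    e + (bit (rises d) + sample d) ≤⟨ +-monoʳ-≤ e (rise-bit+sample≤ d) ⟩
    e + sample (suc d)             ≤⟨ excess+sample≤ fuel (suc d) (suc h) (s≤s z≤n) suc-h≤fuel ⟩
    suc (f (suc h * 2 ^ suc d))    ≤⟨ s≤s (f-mono _ _ (*-mono-≤ (s≤s (z≤n {h})) (m^n>0 2 (suc d))) scaled) ⟩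
    suc (f (suc l * 2 ^ d))        ∎
    where
    open ≤-Reasoning
    e = excessᶠ fuel (suc d) (suc h)
    ring : ∀ b x y → b + x + y ≡ x + (b + y)
    ring = solve-∀
    suc-h≤fuel : suc h ≤ fuel
    suc-h≤fuel = ≤-trans (≤-trans (≤-reflexive (sym half≡)) (⌈n/2⌉≤n l)) l≤fuel
    2+2h≤1+l : double (suc h) ≤ suc l
    2+2h≤1+l = subst (λ x → double x ≤ suc l) half≡ (double⌊n/2⌋≤n (suc l))
    scaled : suc h * 2 ^ suc d ≤ suc l * 2 ^ d
    scaled = begin
      suc h * (2 * 2 ^ d) ≡⟨ *-assoc (suc h) 2 (2 ^ d) ⟨
      suc h * 2 * 2 ^ d   ≡⟨ cong (_* 2 ^ d) (trans (*-comm (suc h) 2) (2*suc≡ h)) ⟩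
      double (suc h) * 2 ^ d ≤⟨ *-monoˡ-≤ (2 ^ d) 2+2h≤1+l ⟩
      suc l * 2 ^ d       ∎

  ones-balanced : ∀ l i i′ → 1 ≤ l → ones 0 i l ≤ ones 0 i′ l + suc (f l)
  ones-balanced l i i′ 1≤l = begin
    ones 0 i l                            ≤⟨ ones≤ones-suc 0 i l ⟩
    ones 0 i (suc l)                      ≤⟨ ones-excess l 0 l i i′ ⟩
    ones 0 i′ l + excessᶠ l 0 l           ≤⟨ +-monoʳ-≤ (ones 0 i′ l) (≤-trans (m≤m+n _ (sample 0)) (excess+sample≤ l 0 l 1≤l ≤-refl)) ⟩
    ones 0 i′ l + suc (f (l * 1))         ≡⟨ cong (λ x → ones 0 i′ l + suc (f x)) (*-identityʳ l) ⟩
    ones 0 i′ l + suc (f l)               ∎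
    where open ≤-Reasoning

  no-rise-at-equal : ∀ {d} → sample d ≡ sample (suc d) → rises d ≡ false
  no-rise-at-equal {d} eq with rises d | <ᵇ-reflects-< (sample d) (sample (suc d))
  ... | true | ofʸ lt = ⊥-elim (<-irrefl eq lt)
  ... | false | _ = refl

  rises-odd : ∀ e → rises (suc (double e)) ≡ false
  rises-odd e = no-rise-at-equal {suc (double e)} (cong (λ x → f (2 ^ double x))
                                       (trans (⌊double/2⌋≡ e) (sym (⌊1+double/2⌋≡ e))))

  rises-zero : rises 0 ≡ false
  rises-zero = no-rise-at-equal {0} refl

  rises-isolated : ∀ d → rises (suc d) ≡ true → rises d ≡ false
  rises-isolated d rise with evenOdd d
  ... | even e rewrite rises-odd e = ⊥-elim (false≢true rise)
    where
    false≢true : false ≢ true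
    false≢true ()
  ... | odd e = rises-odd e

  countRises : ℕ → ℕ → ℕ
  countRises d zero = 0
  countRises d (suc n) = bit (rises d) + countRises (suc d) n

  countRises≤ : ∀ d n → countRises d n ≤ n
  countRises≤ d zero = z≤n
  countRises≤ d (suc n) = +-mono-≤ (bit≤1 (rises d)) (countRises≤ (suc d) n)

  countRises-+ : ∀ d a b → countRises d (a + b) ≡ countRises d a + countRises (d + a) b
  countRises-+ d zero b rewrite +-identityʳ d = refl
  countRises-+ d (suc a) b rewrite countRises-+ (suc d) a b | +-suc d a =
    sym (+-assoc (bit (rises d)) _ _)

  -- Lifting the witnessing windows down one level at a time adds one unit of gap per rise.
  gap-from-rises : ∀ n d → ∃ λ l → ∃ λ g → countRises d n ≤ g ×
                     (Gap d l g ⊎ (rises d ≡ true × Gap⁺ d l g))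
  gap-from-rises zero d = 0 , 0 , z≤n , inj₁ (0 , 0 , ≤-refl)
  gap-from-rises (suc n) d with gap-from-rises n (suc d)
  ... | l , g , count≤g , inj₂ (rise , gap⁺) =
    suc (double l) , g , subst (λ b → bit b + countRises (suc d) n ≤ g) (sym no-rise) count≤g ,
    inj₁ (gap⁺-double-false d l g no-rise gap⁺)
    where
    no-rise = rises-isolated d rise
  ... | l , g , count≤g , inj₁ gap with rises d in rise
  ...   | true = double l , suc g , s≤s count≤g , inj₂ (refl , gap-double-true d l g rise gap)
  ...   | false = double l , g , count≤g , inj₁ (gap-double d l g gap)

  gap-from-rises₀ : ∀ n → ∃ λ l → ∃ λ g → countRises 0 n ≤ g × Gap 0 l g
  gap-from-rises₀ n with gap-from-rises n 0
  ... | l , g , count≤g , inj₁ gap = l , g , count≤g , gap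
  ... | _ , _ , _ , inj₂ (rise , _) with () ← trans (sym rises-zero) rise

  sample-unbounded : ∀ x → ∃ λ d → x < sample d
  sample-unbounded x with f-unbounded x
  ... | n , 1≤n , x<fn = suc (double n) , ≤-trans x<fn (f-mono n _ 1≤n n≤2^2n)
    where
    n≤2^2n : n ≤ 2 ^ double ⌊ double n /2⌋
    n≤2^2n rewrite ⌊double/2⌋≡ n =
      ≤-trans (≤-trans (n≤double n) (<⇒≤ (n<2^n (double n)))) ≤-refl

  rise-between : ∀ d m → sample d < sample (d + m) → 1 ≤ countRises d m
  rise-between d zero lt rewrite +-identityʳ d = ⊥-elim (<-irrefl refl lt)
  rise-between d (suc m) lt with rises d | <ᵇ-reflects-< (sample d) (sample (suc d))
  ... | true | _ = s≤s z≤n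
  ... | false | ofⁿ no-rise =
    rise-between (suc d) m (≤-trans (s≤s (≮⇒≥ no-rise)) (≤-trans lt (≤-reflexive (cong sample (+-suc d m)))))

  countRises-unbounded : ∀ B → ∃ λ n → B ≤ countRises 0 n
  countRises-unbounded zero = 0 , z≤n
  countRises-unbounded (suc B) with countRises-unbounded B
  ... | n , B≤count with sample-unbounded (sample n)
  ...   | d , lt with n ≤? d
  ...     | no n≰d = ⊥-elim (<-irrefl refl (≤-trans lt (sample-mono (≰⇒≥ n≰d))))
  ...     | yes n≤d = n + (d ∸ n) , (begin
    suc B                                      ≡⟨ +-comm 1 B ⟩
    B + 1                                      ≤⟨ +-mono-≤ B≤count (rise-between n (d ∸ n) lt′) ⟩
    countRises 0 n + countRises n (d ∸ n)      ≡⟨ countRises-+ 0 n (d ∸ n) ⟨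
    countRises 0 (n + (d ∸ n))                 ∎)
    where
    open ≤-Reasoning
    lt′ : sample n < sample (n + (d ∸ n))
    lt′ = subst (λ x → sample n < sample x) (sym (m+[n∸m]≡n n≤d)) lt

  unbounded-gaps : ∀ B → ∃ λ l → Gap 0 l B
  unbounded-gaps B with countRises-unbounded B
  ... | n , B≤count with gap-from-rises₀ n
  ...   | l , g , count≤g , (i , i′ , gap) =
    l , i , i′ , ≤-trans (+-monoʳ-≤ (ones 0 i′ l) (≤-trans B≤count count≤g)) gap

  rise-after : ∀ d → ∃ λ t → rises (d + t) ≡ true
  rise-after d with countRises-unbounded (suc d)
  ... | n , d<count with n ≤? d
  ...   | yes n≤d = ⊥-elim (<-irrefl refl (≤-trans d<count (≤-trans (countRises≤ 0 n) n≤d)))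
  ...   | no n≰d = first-rise d (n ∸ d) (+-cancelˡ-≤ d _ _ (begin
    d + 1                                   ≡⟨ +-comm d 1 ⟩
    suc d                                   ≤⟨ d<count ⟩
    countRises 0 n                          ≡⟨ cong (countRises 0) (m+[n∸m]≡n (<⇒≤ (≰⇒> n≰d))) ⟨
    countRises 0 (d + (n ∸ d))              ≡⟨ countRises-+ 0 d (n ∸ d) ⟩
    countRises 0 d + countRises d (n ∸ d)   ≤⟨ +-monoˡ-≤ _ (countRises≤ 0 d) ⟩
    d + countRises d (n ∸ d)                ∎))
    where
    open ≤-Reasoning
    first-rise : ∀ d m → 1 ≤ countRises d m → ∃ λ t → rises (d + t) ≡ true
    first-rise d (suc m) count≥1 with rises d in rise
    ... | true = 0 , trans (cong rises (+-identityʳ d)) rise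
    ... | false with first-rise (suc d) m count≥1
    ...   | t , rise′ = suc t , trans (cong rises (+-suc d t)) rise′

  rises-both : ∀ d b → ∃ λ t → rises (d + t) ≡ b
  rises-both d true = rise-after d
  rises-both d false = suc d , trans (cong rises (trans (+-suc d d) (cong suc (sym (double≡+ d))))) (rises-odd d)

module BlockWord (k : ℕ) (β : ℕ → Bool) where
  open Toeplitz β
  open Blocks k

  L : ℕ
  L = suc (k + k)

  letter : Bool → InfWord
  letter b r with r ≟ k
  ... | yes _ = b
  ... | no _ = false

  letter-centre : ∀ b → letter b k ≡ b
  letter-centre b with k ≟ k
  ... | yes _ = refl
  ... | no k≢k = ⊥-elim (k≢k refl)

  letter-off : ∀ b r → r ≢ k → letter b r ≡ false
  letter-off b r r≢k with r ≟ k
  ... | yes r≡k = ⊥-elim (r≢k r≡k)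
  ... | no _ = refl

  factor-letter : ∀ b → factor (letter b) 0 L ≡ block b
  factor-letter b = begin
    factor (letter b) 0 L                                     ≡⟨ cong (factor (letter b) 0) (+-suc k k) ⟨
    factor (letter b) 0 (k + suc k)                           ≡⟨ factor-+ (letter b) 0 k (suc k) ⟩
    factor (letter b) 0 k ++ letter b k ∷ factor (letter b) (suc k) k
      ≡⟨ cong₂ (λ u c → u ++ c ∷ factor (letter b) (suc k) k) (factor-false (letter b) 0 k before) (letter-centre b) ⟩
    zeros ++ b ∷ factor (letter b) (suc k) k                  ≡⟨ cong (λ u → zeros ++ b ∷ u) (factor-false (letter b) (suc k) k after) ⟩
    zeros ++ b ∷ zeros                                        ∎
    where
    open ≡-Reasoning
    before : ∀ p → p < k → letter b (0 + p) ≡ false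
    before p p<k = letter-off b p (<⇒≢ p<k)
    after : ∀ p → p < k → letter b (suc k + p) ≡ false
    after p _ = letter-off b (suc k + p) (λ eq → <-irrefl (sym eq) (s≤s (m≤m+n k p)))

  base : ℕ → Bool
  base = toeplitz 0

  w : InfWord
  w p = letter (base (p / L)) (p % L)

  w-at : ∀ q r → r < L → w (r + q * L) ≡ letter (base q) r
  w-at q r r<L = cong₂ (λ a c → letter (base a) c) (/-+* L r q r<L) (%-+* L r q r<L)

  w-shift : ∀ x a → w (x + a * L) ≡ letter (base (a + x / L)) (x % L)
  w-shift x a = begin
    w (x + a * L)                        ≡⟨ cong (λ y → w (y + a * L)) (m≡m%n+[m/n]*n x L) ⟩
    w (x % L + x / L * L + a * L)        ≡⟨ cong w (trans (+-assoc (x % L) _ _) (cong (x % L +_) (sym (*-distribʳ-+ L (x / L) a)))) ⟩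
    w (x % L + (x / L + a) * L)          ≡⟨ w-at (x / L + a) (x % L) (m%n<n x L) ⟩
    letter (base (x / L + a)) (x % L)    ≡⟨ cong (λ y → letter (base y) (x % L)) (+-comm (x / L) a) ⟩
    letter (base (a + x / L)) (x % L)    ∎
    where open ≡-Reasoning

  segment : ℕ → ℕ → List Bool
  segment q zero = []
  segment q (suc m) = base q ∷ segment (suc q) m

  length-segment : ∀ q m → length (segment q m) ≡ m
  length-segment q zero = refl
  length-segment q (suc m) = cong suc (length-segment (suc q) m)

  trues-segment : ∀ q m → trues (segment q m) ≡ ones 0 q m
  trues-segment q zero = refl
  trues-segment q (suc m) = cong (bit (base q) +_) (trues-segment (suc q) m)

  factor-in-block : ∀ q e → e ≤ L → factor w (q * L) e ≡ factor (letter (base q)) 0 e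
  factor-in-block q e e≤L = factor-cong w _ (q * L) 0 e
    (λ p p<e → trans (cong w (+-comm (q * L) p)) (w-at q p (≤-trans p<e e≤L)))

  factor-blocks : ∀ m q e → e ≤ L →
                  factor w (q * L) (m * L + e) ≡ blocks (segment q m) ++ factor (letter (base (q + m))) 0 e
  factor-blocks zero q e e≤L rewrite +-identityʳ q = factor-in-block q e e≤L
  factor-blocks (suc m) q e e≤L = begin
    factor w (q * L) (L + m * L + e)                           ≡⟨ cong (factor w (q * L)) (+-assoc L (m * L) e) ⟩
    factor w (q * L) (L + (m * L + e))                         ≡⟨ factor-+ w (q * L) L (m * L + e) ⟩
    factor w (q * L) L ++ factor w (q * L + L) (m * L + e)
      ≡⟨ cong₂ _++_ (trans (factor-in-block q L ≤-refl) (factor-letter (base q)))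
                    (cong (λ t → factor w t (m * L + e)) (+-comm (q * L) L)) ⟩
    block (base q) ++ factor w (suc q * L) (m * L + e)         ≡⟨ cong (block (base q) ++_) (factor-blocks m (suc q) e e≤L) ⟩
    block (base q) ++ (blocks (segment (suc q) m) ++ factor (letter (base (suc q + m))) 0 e)
      ≡⟨ sym (++-assoc (block (base q)) _ _) ⟩
    blocks (segment q (suc m)) ++ factor (letter (base (suc q + m))) 0 e
      ≡⟨ cong (λ t → blocks (segment q (suc m)) ++ factor (letter (base t)) 0 e) (sym (+-suc q m)) ⟩
    blocks (segment q (suc m)) ++ factor (letter (base (q + suc m))) 0 e ∎
    where open ≡-Reasoning

  factor-from-inside : ∀ q r n′ → r < L →
                       factor w (r + q * L) (L ∸ r + n′) ≡ factor (letter (base q)) r (L ∸ r) ++ factor w (suc q * L) n′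
  factor-from-inside q r n′ r<L = trans (factor-+ w (r + q * L) (L ∸ r) n′) (cong₂ _++_
    (factor-cong w _ (r + q * L) r (L ∸ r) (λ p p<L∸r → trans (cong w (ring r (q * L) p)) (w-at q (r + p) (in-block p p<L∸r))))
    (cong (λ t → factor w t n′) next-block))
    where
    ring : ∀ a b c → a + b + c ≡ a + c + b
    ring = solve-∀
    in-block : ∀ p → p < L ∸ r → r + p < L
    in-block p p<L∸r = ≤-trans (+-monoʳ-< r p<L∸r) (≤-reflexive (m+[n∸m]≡n (<⇒≤ r<L)))
    next-block : r + q * L + (L ∸ r) ≡ suc q * L
    next-block = trans (ring r (q * L) (L ∸ r)) (cong (_+ q * L) (m+[n∸m]≡n (<⇒≤ r<L)))

  module _ {n : ℕ} (2L≤n : L + L ≤ n) where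

    full rest : ℕ → ℕ
    full r = (n ∸ (L ∸ r)) / L
    rest r = (n ∸ (L ∸ r)) % L

    shape : ℕ → ℕ → Word
    shape r q = factor (letter (base q)) r (L ∸ r) ++ blocks (segment (suc q) (full r))
                ++ factor (letter (base (suc q + full r))) 0 (rest r)

    factor≡shape : ∀ i → factor w i n ≡ shape (i % L) (i / L)
    factor≡shape i = begin
      factor w i n                                           ≡⟨ cong₂ (factor w) (m≡m%n+[m/n]*n i L) split ⟩
      factor w (r + q * L) (L ∸ r + n′)                      ≡⟨ factor-from-inside q r n′ (m%n<n i L) ⟩
      factor (letter (base q)) r (L ∸ r) ++ factor w (suc q * L) n′
        ≡⟨ cong (λ t → factor (letter (base q)) r (L ∸ r) ++ factor w (suc q * L) t) (trans (m≡m%n+[m/n]*n n′ L) (+-comm (rest r) _)) ⟩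
      factor (letter (base q)) r (L ∸ r) ++ factor w (suc q * L) (full r * L + rest r)
        ≡⟨ cong (factor (letter (base q)) r (L ∸ r) ++_) (factor-blocks (full r) (suc q) (rest r) (<⇒≤ (m%n<n n′ L))) ⟩
      shape r q                                              ∎
      where
      open ≡-Reasoning
      r = i % L
      q = i / L
      n′ = n ∸ (L ∸ r)
      split : n ≡ L ∸ r + n′
      split = sym (m+[n∸m]≡n (≤-trans (m∸n≤m L r) (≤-trans (m≤m+n L L) 2L≤n)))

    1≤full : ∀ r → 1 ≤ full r
    1≤full r = m≥n⇒m/n>0 (begin
      L                   ≡⟨ m+n∸n≡m L L ⟨
      L + L ∸ L           ≤⟨ ∸-mono 2L≤n (≤-refl {L}) ⟩
      n ∸ L               ≤⟨ ∸-monoʳ-≤ n (m∸n≤m L r) ⟩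
      n ∸ (L ∸ r)         ∎)
      where open ≤-Reasoning

    full≤n : ∀ r → full r ≤ n
    full≤n r = ≤-trans (m/n≤m (n ∸ (L ∸ r)) L) (m∸n≤m n (L ∸ r))

    shape-kAbelian : ∀ {r r′} → r ≡ r′ → ∀ q q′ → base q ≡ base q′ → base (suc q + full r) ≡ base (suc q′ + full r′) →
                     ones 0 (suc q) (full r) ≡ ones 0 (suc q′) (full r′) → KAbEq k (shape r q) (shape r′ q′)
    shape-kAbelian {r} refl q q′ same-first same-last same-ones x _ x-short = begin
      occ x (head q ++ blocks (segment (suc q) (full r)) ++ tail q)
        ≡⟨ cong₂ (λ s t → occ x (s ++ blocks (segment (suc q) (full r)) ++ t))
                 (cong (λ b → factor (letter b) r (L ∸ r)) same-first) (cong (λ b → factor (letter b) 0 (rest r)) same-last) ⟩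
      occ x (head q′ ++ blocks (segment (suc q) (full r)) ++ tail q′)
        ≡⟨ occ-framed-blocks-invariant x x-short (head q′) (segment (suc q) (full r)) (segment (suc q′) (full r)) (tail q′)
             (trans (length-segment (suc q) (full r)) (sym (length-segment (suc q′) (full r))))
             (trans (trues-segment (suc q) (full r)) (trans same-ones (sym (trues-segment (suc q′) (full r))))) ⟩
      occ x (head q′ ++ blocks (segment (suc q′) (full r)) ++ tail q′) ∎
      where
      open ≡-Reasoning
      head tail : ℕ → Word
      head q = factor (letter (base q)) r (L ∸ r)
      tail q = factor (letter (base (suc q + full r))) 0 (rest r)

  module _ (D : ℕ → ℕ)
           (D-mono : ∀ l l′ → 1 ≤ l → l ≤ l′ → D l ≤ D l′)
           (balanced : ∀ l i i′ → 1 ≤ l → ones 0 i l ≤ ones 0 i′ l + D l) where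

    module _ {n : ℕ} (2L≤n : L + L ≤ n) where

      private
        r q l : ℕ → ℕ
        r i = i % L
        q i = i / L
        l i = full 2L≤n (r i)
        first last : ℕ → Bool
        first i = base (q i)
        last i = base (suc (q i) + l i)
        inner reference : ℕ → ℕ
        inner i = ones 0 (suc (q i)) (l i)
        reference i = ones 0 0 (l i)

      -- By balance the inner count lies within D of the count at the origin, so this is bounded.
      offset : ℕ → ℕ
      offset i = inner i + D (l i) ∸ reference i
      code : ℕ → ℕ
      code i = r i + (bit (first i) + (bit (last i) + offset i * 2) * 2) * L

      reference≤ : ∀ i → reference i ≤ inner i + D (l i)
      reference≤ i = balanced (l i) 0 (suc (q i)) (1≤full 2L≤n (r i))

      code-kAbelian : ∀ i j → code i ≡ code j → KAbEq k (factor w i n) (factor w j n)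
      code-kAbelian i j same-code
        with divMod-unique L (m%n<n i L) (m%n<n j L) same-code
      ... | same-r , same-X with divMod-unique 2 (bit<2 (first i)) (bit<2 (first j)) same-X
      ... | same-first , same-Y with divMod-unique 2 (bit<2 (last i)) (bit<2 (last j)) same-Y
      ... | same-last , same-offset = subst₂ (KAbEq k) (sym (factor≡shape 2L≤n i)) (sym (factor≡shape 2L≤n j))
        (shape-kAbelian 2L≤n same-r (q i) (q j) (bit-injective _ _ same-first) (bit-injective _ _ same-last)
          (same-inner same-r (inner i) (inner j) (reference≤ i) (reference≤ j) same-offset))
        where
        same-inner : ∀ {ρ ρ′} → ρ ≡ ρ′ → ∀ a a′ → let c = ones 0 0 (full 2L≤n ρ) ; c′ = ones 0 0 (full 2L≤n ρ′) in
                     c ≤ a + D (full 2L≤n ρ) → c′ ≤ a′ + D (full 2L≤n ρ′) →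
                     a + D (full 2L≤n ρ) ∸ c ≡ a′ + D (full 2L≤n ρ′) ∸ c′ → a ≡ a′
        same-inner refl a a′ c≤ c≤′ eq = +-cancelʳ-≡ _ a a′ (∸-cancelʳ-≡ c≤ c≤′ eq)

      offset≤ : ∀ i → offset i ≤ D n + D n
      offset≤ i = begin
        inner i + D (l i) ∸ reference i               ≤⟨ ∸-monoˡ-≤ (reference i) (+-monoˡ-≤ (D (l i)) (balanced (l i) (suc (q i)) 0 (1≤full 2L≤n (r i)))) ⟩
        reference i + D (l i) + D (l i) ∸ reference i ≡⟨ cong (_∸ reference i) (+-assoc (reference i) _ _) ⟩
        reference i + (D (l i) + D (l i)) ∸ reference i ≡⟨ m+n∸m≡n (reference i) _ ⟩
        D (l i) + D (l i)                             ≤⟨ +-mono-≤ D≤ D≤ ⟩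
        D n + D n                                     ∎
        where
        open ≤-Reasoning
        D≤ : D (l i) ≤ D n
        D≤ = D-mono _ _ (1≤full 2L≤n (r i)) (full≤n 2L≤n (r i))

      code< : ∀ i → code i < 4 * suc (D n + D n) * L
      code< i = begin-strict
        r i + X * L           <⟨ +-monoˡ-< (X * L) (m%n<n i L) ⟩
        suc X * L             ≤⟨ *-monoˡ-≤ L X< ⟩
        4 * suc (D n + D n) * L ∎
        where
        open ≤-Reasoning
        X = bit (first i) + (bit (last i) + offset i * 2) * 2
        X< : suc X ≤ 4 * suc (D n + D n)
        X< = begin
          suc X                                   ≤⟨ s≤s (+-mono-≤ (bit≤1 (first i)) (*-monoˡ-≤ 2 (+-mono-≤ (bit≤1 (last i)) (*-monoˡ-≤ 2 (offset≤ i))))) ⟩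
          suc (1 + (1 + (D n + D n) * 2) * 2)     ≡⟨ ring (D n + D n) ⟩
          4 * suc (D n + D n)                     ∎
          where
          ring : ∀ E → suc (1 + (1 + E * 2) * 2) ≡ 4 * suc E
          ring = solve-∀

    abComplexity≤ : ∀ n m → L + L ≤ n → AbComplexityIs k w n m → m ≤ 4 * suc (D n + D n) * L
    abComplexity≤ n m 2L≤n (ps , refl , unrelated , _) =
      length≤-by-code (code 2L≤n) _ (code< 2L≤n) (code-kAbelian 2L≤n) ps unrelated

  w-periodic : ∀ K p Q → suc (p / L) < 2 ^ K → w (p + Q * (L * 2 ^ K)) ≡ w p
  w-periodic K p Q p<2^K = begin
    w (p + Q * (L * 2 ^ K))                 ≡⟨ cong (λ t → w (p + t)) (ring Q L (2 ^ K)) ⟩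
    w (p + (Q * 2 ^ K) * L)                 ≡⟨ w-shift p (Q * 2 ^ K) ⟩
    letter (base (Q * 2 ^ K + p / L)) (p % L) ≡⟨ cong (λ t → letter (base t) (p % L)) (+-comm (Q * 2 ^ K) (p / L)) ⟩
    letter (base (p / L + Q * 2 ^ K)) (p % L) ≡⟨ cong (λ b → letter b (p % L)) (toeplitz-periodic K 0 Q (p / L) p<2^K) ⟩
    letter (base (0 + p / L)) (p % L)       ≡⟨ w-shift p 0 ⟨
    w (p + 0 * L)                           ≡⟨ cong w (+-identityʳ p) ⟩
    w p                                     ∎
    where
    open ≡-Reasoning
    ring : ∀ Q L P → Q * (L * P) ≡ (Q * P) * L
    ring = solve-∀

  uniformly-recurrent : UniformlyRecurrent w
  uniformly-recurrent u (i , occurs) = P + i + length u , recurrent-if-periodic w u i P recurs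
    where
    K = i + length u
    P = L * 2 ^ K
    instance
      P≢0 : NonZero P
      P≢0 = m*n≢0 L (2 ^ K) {{_}} {{m^n≢0 2 K}}
    recurs : ∀ Q → factor w (i + Q * P) (length u) ≡ u
    recurs Q = trans (factor-cong w w (i + Q * P) i (length u) same) occurs
      where
      ring : ∀ a b c → a + b + c ≡ a + c + b
      ring = solve-∀
      same : ∀ p → p < length u → w (i + Q * P + p) ≡ w (i + p)
      same p p<|u| = trans (cong w (ring i (Q * P) p))
        (w-periodic K (i + p) Q (≤-trans (s≤s (s≤s (m/n≤m (i + p) L))) (≤-trans (s≤s (+-monoʳ-< i p<|u|)) (n<2^n K))))

  module _ (both : ∀ d b → ∃ λ t → β (d + t) ≡ b) where

    w-cover : ∀ n → ∃ λ M → ∀ i → ∃ λ j → j < M × factor w i n ≡ factor w j n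
    w-cover n with toeplitz-cover both 0 (L + n)
    ... | M , cover = M * L , λ i → from (i % L) (i / L) (m%n<n i L) (m≡m%n+[m/n]*n i L)
      where
      from : ∀ r a {i} → r < L → i ≡ r + a * L → ∃ λ j → j < M * L × factor w i n ≡ factor w j n
      from r a {i} r<L i≡ with cover a
      ... | a₀ , a₀<M , agree = r + a₀ * L , ≤-trans (+-monoˡ-< (a₀ * L) r<L) (*-monoˡ-≤ L a₀<M) ,
        factor-cong w w i (r + a₀ * L) n same
        where
        ring : ∀ a b c → a + b + c ≡ a + c + b
        ring = solve-∀
        same : ∀ p → p < n → w (i + p) ≡ w (r + a₀ * L + p)
        same p p<n = begin
          w (i + p)                                         ≡⟨ cong (λ y → w (y + p)) i≡ ⟩
          w (r + a * L + p)                                 ≡⟨ cong w (ring r (a * L) p) ⟩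
          w (r + p + a * L)                                 ≡⟨ w-shift (r + p) a ⟩
          letter (base (a + (r + p) / L)) ((r + p) % L)     ≡⟨ cong (λ b → letter b ((r + p) % L)) (agree ((r + p) / L) within) ⟩
          letter (base (a₀ + (r + p) / L)) ((r + p) % L)    ≡⟨ w-shift (r + p) a₀ ⟨
          w (r + p + a₀ * L)                                ≡⟨ cong w (ring r (a₀ * L) p) ⟨
          w (r + a₀ * L + p)                                ∎
          where
          open ≡-Reasoning
          within : (r + p) / L < L + n
          within = ≤-trans (s≤s (m/n≤m (r + p) L)) (+-mono-≤ r<L (<⇒≤ p<n))

    w-abComplexity-exists : ∀ n → ∃ λ m → AbComplexityIs k w n m
    w-abComplexity-exists n = abComplexity-of-cover k w n (proj₁ (w-cover n)) (proj₂ (w-cover n))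

  occ-true-blocks : ∀ p l → occ (true ∷ []) (factor w (p * L) (l * L)) ≡ ones 0 p l
  occ-true-blocks p l = begin
    occ (true ∷ []) (factor w (p * L) (l * L))      ≡⟨ cong (occ (true ∷ []) ∘ factor w (p * L)) (sym (+-identityʳ (l * L))) ⟩
    occ (true ∷ []) (factor w (p * L) (l * L + 0))  ≡⟨ cong (occ (true ∷ [])) (factor-blocks l p 0 z≤n) ⟩
    occ (true ∷ []) (blocks (segment p l) ++ [])    ≡⟨ occ-true≡trues (blocks (segment p l) ++ []) ⟩
    trues (blocks (segment p l) ++ [])              ≡⟨ cong trues (++-identityʳ (blocks (segment p l))) ⟩
    trues (blocks (segment p l))                    ≡⟨ trues-blocks (segment p l) ⟩
    trues (segment p l)                             ≡⟨ trues-segment p l ⟩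
    ones 0 p l                                      ∎
    where open ≡-Reasoning

  -- Every count of ones between the two ends of a gap is realised, and k ≥ 1 sees that count.
  gap<abComplexity : 1 ≤ k → ∀ B l → Gap 0 l B → ∀ m → AbComplexityIs k w (l * L) m → B < m
  gap<abComplexity 1≤k B l (i , i′ , gap) m (ps , refl , _ , covered) = begin
    suc B              ≡⟨ length-values ⟨
    length values      ≤⟨ distinct-⊆⇒length≤ values counts distinct realised ⟩
    length counts      ≡⟨ length-map count ps ⟩
    length ps          ∎
    where
    open ≤-Reasoning
    count : ℕ → ℕ
    count j = occ (true ∷ []) (factor w j (l * L))
    low = ones 0 i′ l
    values counts : List ℕ
    values = map (low +_) (downFrom (suc B))
    counts = map count ps
    length-values : length values ≡ suc B
    length-values = trans (length-map (low +_) (downFrom (suc B))) (length-downFrom (suc B))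
    distinct : AllPairs _≢_ values
    distinct = AllPairs.map⁺ (AllPairs.map (λ s≢s′ eq → s≢s′ (+-cancelˡ-≡ low _ _ eq)) (downFrom⁺ (suc B)))
    hit : ∀ s → s < suc B → low + s ∈ counts
    hit s s<1+B with intermediate-value (λ j → ones 0 j l) (ones-step-up 0 l) (ones-step-down 0 l) i i′ (low + s)
                       (m≤m+n low s) (≤-trans (+-monoʳ-≤ low (≤-pred s<1+B)) gap)
    ... | p , ones≡ = Any.map⁺ (Any.map (λ p≈j → trans (sym ones≡) (trans (sym (occ-true-blocks p l)) (p≈j (true ∷ []) ≤-refl 1≤k)))
                                        (covered (p * L)))
    realised : All (_∈ counts) values
    realised = All.map⁺ (All.tabulate (λ {s} s∈ → hit s (∈-downFrom⁻ s∈)))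

20L-bound : ∀ L x → 1 ≤ x → 4 * suc (suc x + suc x) * L ≤ 20 * L * x
20L-bound L (suc y) _ = begin
  4 * suc (suc (suc y) + suc (suc y)) * L   ≡⟨ ring y L ⟩
  (8 * y + 20) * L                          ≤⟨ *-monoˡ-≤ L (+-monoˡ-≤ 20 (*-monoˡ-≤ y (m≤m+n 8 12))) ⟩
  (20 * y + 20) * L                         ≡⟨ ring′ y L ⟩
  20 * L * suc y                            ∎
  where
  open ≤-Reasoning
  ring : ∀ y L → 4 * suc (suc (suc y) + suc (suc y)) * L ≡ (8 * y + 20) * L
  ring = solve-∀
  ring′ : ∀ y L → (20 * y + 20) * L ≡ 20 * L * suc y
  ring′ = solve-∀

theorem5 : (k : ℕ) → 1 ≤ k →
    (f : ℕ → ℕ) →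
    ((n : ℕ) → 1 ≤ n → 1 ≤ f n) →
    ((m n : ℕ) → 1 ≤ m → m ≤ n → f m ≤ f n) →
    ((B : ℕ) → ∃ λ n → 1 ≤ n × B < f n) →
    ∃ λ (w : InfWord) →
      UniformlyRecurrent w ×
      (∃ λ C → ∃ λ N → (n m : ℕ) → N ≤ n → AbComplexityIs k w n m → m ≤ C * f n) ×
      ((B : ℕ) → ∃ λ n → ∃ λ m → AbComplexityIs k w n m × B < m)
theorem5 k 1≤k f f-positive f-mono f-unbounded = w , uniformly-recurrent , (20 * L , L + L , upper) , lower
  where
  open Rises f f-mono f-unbounded using (rises; rises-both; ones-balanced; unbounded-gaps)
  open BlockWord k rises
  upper : ∀ n m → L + L ≤ n → AbComplexityIs k w n m → m ≤ 20 * L * f n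
  upper n m 2L≤n classes = ≤-trans
    (abComplexity≤ (λ l → suc (f l)) (λ l l′ 1≤l l≤l′ → s≤s (f-mono l l′ 1≤l l≤l′)) ones-balanced n m 2L≤n classes)
    (20L-bound L (f n) (f-positive n (≤-trans (s≤s z≤n) 2L≤n)))
  lower : ∀ B → ∃ λ n → ∃ λ m → AbComplexityIs k w n m × B < m
  lower B with unbounded-gaps B
  ... | l , gap with w-abComplexity-exists rises-both (l * L)
  ...   | m , classes = l * L , m , classes , gap<abComplexity 1≤k B l gap m classes
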